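{- Let $M$ be the adjacency matrix of a strongly regular graph $G$ with parameters $(n,k,\lambda,\mu)$ with $\lambda=\mu$. If there exists a fixed point free Seidel automorphism of $G$ with permutation matrix $P$, then $M+P$ is the adjacency matrix of a Deza graph with strongly regular children whose adjacency matrices are $PM$ and $J-I-PM$.
   Context: A strongly regular graph with parameters $(n,k,\lambda,\mu)$ is a $k$-regular graph on $n$ vertices in which any two distinct adjacent vertices have exactly $\lambda$ common neighbours and any two distinct non-adjacent vertices have exactly $\mu$ common neighbours. A Deza graph with parameters $(n,k,b,a)$, $b\ge a$, is a $k$-regular connected graph on $n$ vertices such that any two distinct vertices have either $b$ or $a$ common neighbours; equivalently its adjacency matrix $N$ satisfies $N^2=aA+bB+kI$ for symmetric $(0,1)$-matrices $A,B$ with $A+B+I=J$ ($J$ the all-ones matrix); the graphs with adjacency matrices $A$ and $B$ are its children. A Seidel automorphism of a graph is an involutive automorphism $\varphi$ ($\varphi^2=\mathrm{id}$, $\varphi\ne\mathrm{id}$) such that for every vertex $v$ with $\varphi(v)\neq v$, $v$ and $\varphi(v)$ are non-adjacent; fixed point free means $\varphi(v)\ne v$ for all $v$. Its permutation matrix $P$ has $P_{u,v}=1$ iff $v=\varphi(u)$. -}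

module Defs where

open import Data.Nat using (ℕ; zero; suc; _+_; _*_; _∸_; _≤_)
open import Data.Fin using (Fin; zero; suc; _≟_)
open import Data.Product using (Σ; _×_; _,_; ∃)
open import Data.Sum using (_⊎_)
open import Relation.Nullary using (¬_; yes; no)
open import Relation.Binary.PropositionalEquality using (_≡_; _≢_)
open import Relation.Binary.Construct.Closure.ReflexiveTransitive using (Star)

Matrix : ℕ → Set
Matrix n = Fin n → Fin n → ℕ

infixl 6 _⊕_ _⊖_
infixl 7 _⊗_ _·_

∑ : ∀ {n} → (Fin n → ℕ) → ℕ
∑ {zero} f = 0
∑ {suc n} f = f zero + ∑ (λ i → f (suc i))

_⊗_ : ∀ {n} → Matrix n → Matrix n → Matrix n
(A ⊗ B) i j = ∑ (λ l → A i l * B l j)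

_⊕_ : ∀ {n} → Matrix n → Matrix n → Matrix n
(A ⊕ B) i j = A i j + B i j

_·_ : ∀ {n} → ℕ → Matrix n → Matrix n
(c · A) i j = c * A i j

I : ∀ {n} → Matrix n
I i j with i ≟ j
... | yes _ = 1
... | no _ = 0

J : ∀ {n} → Matrix n
J i j = 1

-- (truncated) entrywise subtraction; only applied where no truncation occurs
_⊖_ : ∀ {n} → Matrix n → Matrix n → Matrix n
(A ⊖ B) i j = A i j ∸ B i j

Symmetric01 : ∀ {n} → Matrix n → Set
Symmetric01 {n} A = (∀ i j → A i j ≡ 0 ⊎ A i j ≡ 1) × (∀ i j → A i j ≡ A j i)

IsAdjacency : ∀ {n} → Matrix n → Set
IsAdjacency {n} M = Symmetric01 M × (∀ i → M i i ≡ 0)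

Regular : ∀ {n} → ℕ → Matrix n → Set
Regular k M = ∀ i → ∑ (M i) ≡ k

Adj : ∀ {n} → Matrix n → Fin n → Fin n → Set
Adj M i j = M i j ≡ 1

Connected : ∀ {n} → Matrix n → Set
Connected {n} M = ∀ (i j : Fin n) → Star (Adj M) i j

IsSRG : (n k lam mu : ℕ) → Matrix n → Set
IsSRG n k lam mu M =
  IsAdjacency M × Regular k M ×
  (∀ i j → i ≢ j → M i j ≡ 1 → (M ⊗ M) i j ≡ lam) ×
  (∀ i j → i ≢ j → M i j ≡ 0 → (M ⊗ M) i j ≡ mu)

IsStronglyRegular : ∀ {n} → Matrix n → Set
IsStronglyRegular {n} M = Σ ℕ λ k → Σ ℕ λ lam → Σ ℕ λ mu → IsSRG n k lam mu M

IsDezaWithChildren : (n k b a : ℕ) → (N A B : Matrix n) → Set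
IsDezaWithChildren n k b a N A B =
  IsAdjacency N × Regular k N × Connected N × a ≤ b ×
  Symmetric01 A × Symmetric01 B ×
  (∀ i j → (A ⊕ B ⊕ I) i j ≡ J i j) ×
  (∀ i j → (N ⊗ N) i j ≡ ((a · A) ⊕ (b · B) ⊕ (k · I)) i j)

IsSeidelAutomorphism : ∀ {n} → Matrix n → (Fin n → Fin n) → Set
IsSeidelAutomorphism {n} M φ =
  (∀ v → φ (φ v) ≡ v) ×
  (¬ (∀ v → φ v ≡ v)) ×
  (∀ u v → M (φ u) (φ v) ≡ M u v) ×
  (∀ v → φ v ≢ v → M v (φ v) ≡ 0)

FixedPointFree : ∀ {n} → (Fin n → Fin n) → Set
FixedPointFree φ = ∀ v → φ v ≢ v

permMatrix : ∀ {n} → (Fin n → Fin n) → Matrix n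
permMatrix φ u v with v ≟ φ u
... | yes _ = 1
... | no _ = 0

-- Let P be the permutation matrix of φ and B = PM. Since φ is an involutive automorphism,
-- PM = MP and P² = I, and since φ is fixed point free and Seidel, M and P have disjoint
-- supports, so N = M + P is a graph with N² = M² + 2B + I. For λ = μ we have
-- M² = kI + λ(J − I), whence N² = λ(J − I − B) + (λ + 2)B + (k + 1)I. Moreover
-- B² = M² conjugated by P, which is again kI + λ(J − I), so B is strongly regular, and so
-- is its complement J − I − B.
module Submission where

open import Defs
open import Data.Nat using (ℕ; zero; suc; _+_; _*_; _∸_)
open import Data.Nat.Properties using (m+n∸n≡m; m≤n+m; +-comm; +-assoc; +-identityʳ; *-zeroʳ; *-identityʳ; *-distribˡ-+; *-distribʳ-+)
open import Data.Nat.Tactic.RingSolver using (solve-∀; solve)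
open import Data.List using (_∷_; [])
open import Data.Fin using (Fin; zero; suc; _≟_)
open import Data.Fin.Properties using (suc-injective)
open import Data.Product using (Σ; _×_; _,_; proj₁; proj₂)
open import Data.Sum using (_⊎_; inj₁; inj₂)
open import Data.Empty using (⊥-elim)
open import Function using (id; _∘_)
open import Relation.Nullary using (Dec; yes; no)
open import Relation.Binary.PropositionalEquality hiding (J)
import Relation.Binary.Construct.Closure.ReflexiveTransitive as Star

private
  variable
    n : ℕ

infix 4 _≐_

_≐_ : Matrix n → Matrix n → Set
A ≐ B = ∀ i j → A i j ≡ B i j

IsBit : ℕ → Set
IsBit x = x ≡ 0 ⊎ x ≡ 1

∑-cong : {f g : Fin n → ℕ} → (∀ i → f i ≡ g i) → ∑ f ≡ ∑ g
∑-cong {zero}  f≗g = refl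
∑-cong {suc n} f≗g = cong₂ _+_ (f≗g zero) (∑-cong (f≗g ∘ suc))

∑-distrib-+ : (f g : Fin n → ℕ) → ∑ (λ i → f i + g i) ≡ ∑ f + ∑ g
∑-distrib-+ {zero}  f g = refl
∑-distrib-+ {suc n} f g = begin
  (f zero + g zero) + ∑ (λ i → f (suc i) + g (suc i))
    ≡⟨ cong ((f zero + g zero) +_) (∑-distrib-+ (f ∘ suc) (g ∘ suc)) ⟩
  (f zero + g zero) + (∑ (f ∘ suc) + ∑ (g ∘ suc))
    ≡⟨ interchange (f zero) (g zero) _ _ ⟩
  (f zero + ∑ (f ∘ suc)) + (g zero + ∑ (g ∘ suc)) ∎
  where
  open ≡-Reasoning
  interchange : ∀ a b c d → (a + b) + (c + d) ≡ (a + c) + (b + d)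
  interchange = solve-∀

∑-one : ∑ {n} (λ _ → 1) ≡ n
∑-one {zero}  = refl
∑-one {suc n} = cong suc ∑-one

∑-zero : (f : Fin n → ℕ) → (∀ i → f i ≡ 0) → ∑ f ≡ 0
∑-zero {zero}  f f≗0 = refl
∑-zero {suc n} f f≗0 = cong₂ _+_ (f≗0 zero) (∑-zero (f ∘ suc) (f≗0 ∘ suc))

∑-single : (f : Fin n → ℕ) (c : Fin n) → (∀ i → i ≢ c → f i ≡ 0) → ∑ f ≡ f c
∑-single {suc n} f zero    f≗0 =
  trans (cong (f zero +_) (∑-zero (f ∘ suc) (λ i → f≗0 (suc i) λ ()))) (+-identityʳ (f zero))
∑-single {suc n} f (suc c) f≗0 =
  cong₂ _+_ (f≗0 zero λ ()) (∑-single (f ∘ suc) c (λ i i≢c → f≗0 (suc i) (i≢c ∘ suc-injective)))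

I-diag : (i : Fin n) → I i i ≡ 1
I-diag i with i ≟ i
... | yes _   = refl
... | no i≢i = ⊥-elim (i≢i refl)

I-off : {i j : Fin n} → i ≢ j → I i j ≡ 0
I-off {i = i} {j} i≢j with i ≟ j
... | yes i≡j = ⊥-elim (i≢j i≡j)
... | no _    = refl

permMatrix-hit : (φ : Fin n → Fin n) {u v : Fin n} → v ≡ φ u → permMatrix φ u v ≡ 1
permMatrix-hit φ {u} {v} v≡φu with v ≟ φ u
... | yes _    = refl
... | no v≢φu = ⊥-elim (v≢φu v≡φu)

permMatrix-miss : (φ : Fin n → Fin n) {u v : Fin n} → v ≢ φ u → permMatrix φ u v ≡ 0
permMatrix-miss φ {u} {v} v≢φu with v ≟ φ u
... | yes v≡φu = ⊥-elim (v≢φu v≡φu)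
... | no _     = refl

permMatrix-row-cong : (φ ψ : Fin n → Fin n) {u w : Fin n} → φ u ≡ ψ w →
                      ∀ v → permMatrix φ u v ≡ permMatrix ψ w v
permMatrix-row-cong φ ψ {u} φu≡ψw v with v ≟ φ u
... | yes v≡φu = sym (permMatrix-hit ψ (trans v≡φu φu≡ψw))
... | no v≢φu  = sym (permMatrix-miss ψ (λ v≡ψw → v≢φu (trans v≡ψw (sym φu≡ψw))))

I≐permMatrix-id : I ≐ permMatrix {n} id
I≐permMatrix-id i j with i ≟ j
... | yes i≡j = sym (permMatrix-hit id (sym i≡j))
... | no i≢j  = sym (permMatrix-miss id (i≢j ∘ sym))

permMatrix-⊗ : (φ : Fin n → Fin n) (A : Matrix n) → permMatrix φ ⊗ A ≐ λ i j → A (φ i) j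
permMatrix-⊗ φ A i j = begin
  ∑ (λ l → permMatrix φ i l * A l j)
    ≡⟨ ∑-single _ (φ i) (λ l l≢φi → cong (_* A l j) (permMatrix-miss φ l≢φi)) ⟩
  permMatrix φ i (φ i) * A (φ i) j
    ≡⟨ cong (_* A (φ i) j) (permMatrix-hit φ refl) ⟩
  A (φ i) j + 0
    ≡⟨ +-identityʳ _ ⟩
  A (φ i) j ∎
  where open ≡-Reasoning

-- For an involution, column j of the permutation matrix has its 1 in row φ j.
⊗-permMatrix : (φ : Fin n → Fin n) → (∀ v → φ (φ v) ≡ v) →
               (A : Matrix n) → A ⊗ permMatrix φ ≐ λ i j → A i (φ j)
⊗-permMatrix φ φ-invol A i j = begin
  ∑ (λ l → A i l * permMatrix φ l j)
    ≡⟨ ∑-single _ (φ j) (λ l l≢φj → trans (cong (A i l *_) (permMatrix-miss φ (l≢φj ∘ from-φ)))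
                                           (*-zeroʳ (A i l))) ⟩
  A i (φ j) * permMatrix φ (φ j) j
    ≡⟨ cong (A i (φ j) *_) (permMatrix-hit φ (sym (φ-invol j))) ⟩
  A i (φ j) * 1
    ≡⟨ *-identityʳ _ ⟩
  A i (φ j) ∎
  where
  open ≡-Reasoning
  from-φ : ∀ {l} → j ≡ φ l → l ≡ φ j
  from-φ {l} j≡φl = trans (sym (φ-invol l)) (cong φ (sym j≡φl))

∑-row-permMatrix : (φ : Fin n → Fin n) (i : Fin n) → ∑ (permMatrix φ i) ≡ 1
∑-row-permMatrix φ i =
  trans (∑-single (permMatrix φ i) (φ i) (λ l → permMatrix-miss φ)) (permMatrix-hit φ refl)

I-⊗ : (A : Matrix n) → I ⊗ A ≐ A
I-⊗ A i j = trans (∑-cong (λ l → cong (_* A l j) (I≐permMatrix-id i l))) (permMatrix-⊗ id A i j)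

⊗-I : (A : Matrix n) → A ⊗ I ≐ A
⊗-I A i j = trans (∑-cong (λ l → cong (A i l *_) (I≐permMatrix-id l j))) (⊗-permMatrix id (λ _ → refl) A i j)

I-sym : (i j : Fin n) → I i j ≡ I j i
I-sym i j with i ≟ j
... | yes refl = sym (I-diag i)
... | no i≢j   = sym (I-off (i≢j ∘ sym))

∑-row-I : (i : Fin n) → ∑ (I i) ≡ 1
∑-row-I i = trans (∑-cong (I≐permMatrix-id i)) (∑-row-permMatrix id i)

⊗-distribʳ-⊕ : (A B C : Matrix n) → (A ⊕ B) ⊗ C ≐ (A ⊗ C) ⊕ (B ⊗ C)
⊗-distribʳ-⊕ A B C i j =
  trans (∑-cong (λ l → *-distribʳ-+ (C l j) (A i l) (B i l)))
        (∑-distrib-+ (λ l → A i l * C l j) (λ l → B i l * C l j))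

⊗-distribˡ-⊕ : (A B C : Matrix n) → A ⊗ (B ⊕ C) ≐ (A ⊗ B) ⊕ (A ⊗ C)
⊗-distribˡ-⊕ A B C i j =
  trans (∑-cong (λ l → *-distribˡ-+ (A i l) (B l j) (C l j)))
        (∑-distrib-+ (λ l → A i l * B l j) (λ l → A i l * C l j))

⊕-⊗-⊕ : (A B C D : Matrix n) → (A ⊕ B) ⊗ (C ⊕ D) ≐ ((A ⊗ C) ⊕ (A ⊗ D)) ⊕ ((B ⊗ C) ⊕ (B ⊗ D))
⊕-⊗-⊕ A B C D i j = trans (⊗-distribʳ-⊕ A B (C ⊕ D) i j)
  (cong₂ _+_ (⊗-distribˡ-⊕ A C D i j) (⊗-distribˡ-⊕ B C D i j))

bit-square : {x : ℕ} → IsBit x → x * x ≡ x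
bit-square (inj₁ refl) = refl
bit-square (inj₂ refl) = refl

bit-complement : {x : ℕ} → IsBit x → IsBit (1 ∸ x)
bit-complement (inj₁ refl) = inj₂ refl
bit-complement (inj₂ refl) = inj₁ refl

bit-complement-+ : {x : ℕ} → IsBit x → (1 ∸ x) + x ≡ 1
bit-complement-+ (inj₁ refl) = refl
bit-complement-+ (inj₂ refl) = refl

bit-complement-* : {x y : ℕ} → IsBit x → IsBit y → (1 ∸ x) * (1 ∸ y) + x + y ≡ 1 + x * y
bit-complement-* (inj₁ refl) (inj₁ refl) = refl
bit-complement-* (inj₁ refl) (inj₂ refl) = refl
bit-complement-* (inj₂ refl) (inj₁ refl) = refl
bit-complement-* (inj₂ refl) (inj₂ refl) = refl

m+n≡o⇒m≡o∸n : {m n o : ℕ} → m + n ≡ o → m ≡ o ∸ n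
m+n≡o⇒m≡o∸n {m} {n} m+n≡o = trans (sym (m+n∸n≡m m n)) (cong (_∸ n) m+n≡o)

module _ (X : Matrix n) (X-bit : ∀ i j → IsBit (X i j)) where

  ∑-row-complement : ∀ i → ∑ ((J ⊖ X) i) + ∑ (X i) ≡ n
  ∑-row-complement i = begin
    ∑ ((J ⊖ X) i) + ∑ (X i)          ≡⟨ ∑-distrib-+ ((J ⊖ X) i) (X i) ⟨
    ∑ (λ l → (1 ∸ X i l) + X i l)    ≡⟨ ∑-cong (λ l → bit-complement-+ (X-bit i l)) ⟩
    ∑ {n} (λ _ → 1)                  ≡⟨ ∑-one ⟩
    n                                ∎
    where open ≡-Reasoning

  complement-⊗-complement : ∀ i j →
    ((J ⊖ X) ⊗ (J ⊖ X)) i j + ∑ (X i) + ∑ (λ l → X l j) ≡ n + (X ⊗ X) i j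
  complement-⊗-complement i j = begin
    ((J ⊖ X) ⊗ (J ⊖ X)) i j + ∑ (X i) + ∑ (λ l → X l j)
      ≡⟨ cong (_+ ∑ (λ l → X l j)) (∑-distrib-+ (λ l → (1 ∸ X i l) * (1 ∸ X l j)) (X i)) ⟨
    ∑ (λ l → (1 ∸ X i l) * (1 ∸ X l j) + X i l) + ∑ (λ l → X l j)
      ≡⟨ ∑-distrib-+ (λ l → (1 ∸ X i l) * (1 ∸ X l j) + X i l) (λ l → X l j) ⟨
    ∑ (λ l → (1 ∸ X i l) * (1 ∸ X l j) + X i l + X l j)
      ≡⟨ ∑-cong (λ l → bit-complement-* (X-bit i l) (X-bit l j)) ⟩
    ∑ (λ l → 1 + X i l * X l j)
      ≡⟨ ∑-distrib-+ (λ _ → 1) (λ l → X i l * X l j) ⟩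
    ∑ {n} (λ _ → 1) + (X ⊗ X) i j
      ≡⟨ cong (_+ (X ⊗ X) i j) ∑-one ⟩
    n + (X ⊗ X) i j ∎
    where open ≡-Reasoning

module _ {B : Matrix n} (B-adjacency : IsAdjacency B) where

  private
    B-bit = B-adjacency .proj₁ .proj₁
    B-diag = B-adjacency .proj₂

  I⊕-diag : ∀ i → (I ⊕ B) i i ≡ 1
  I⊕-diag i = cong₂ _+_ (I-diag i) (B-diag i)

  I⊕-bit : ∀ i j → IsBit ((I ⊕ B) i j)
  I⊕-bit i j = by-cases (i ≟ j)
    where
    by-cases : Dec (i ≡ j) → IsBit ((I ⊕ B) i j)
    by-cases (yes i≡j) = inj₂ (subst (λ l → (I ⊕ B) i l ≡ 1) i≡j (I⊕-diag i))
    by-cases (no i≢j)  = subst IsBit (cong (_+ B i j) (sym (I-off i≢j))) (B-bit i j)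

  complement-⊕-⊕-I : (J ⊖ (I ⊕ B)) ⊕ B ⊕ I ≐ J
  complement-⊕-⊕-I i j = begin
    (1 ∸ (I i j + B i j)) + B i j + I i j      ≡⟨ +-assoc (1 ∸ (I i j + B i j)) (B i j) (I i j) ⟩
    (1 ∸ (I i j + B i j)) + (B i j + I i j)    ≡⟨ cong ((1 ∸ (I i j + B i j)) +_) (+-comm (B i j) (I i j)) ⟩
    (1 ∸ (I i j + B i j)) + (I i j + B i j)    ≡⟨ bit-complement-+ (I⊕-bit i j) ⟩
    1                                          ∎
    where open ≡-Reasoning

module _ {n k lam mu : ℕ} {B : Matrix n} (srg : IsSRG n k lam mu B) where

  private
    B-bit = srg .proj₁ .proj₁ .proj₁
    B-sym = srg .proj₁ .proj₁ .proj₂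
    B-reg = srg .proj₂ .proj₁
    B-adj = srg .proj₂ .proj₂ .proj₁
    B-nonadj = srg .proj₂ .proj₂ .proj₂

    X : Matrix n
    X = I ⊕ B

    C : Matrix n
    C = J ⊖ X

    X-bit : ∀ i j → IsBit (X i j)
    X-bit = I⊕-bit (srg .proj₁)

    X-sym : ∀ i j → X i j ≡ X j i
    X-sym i j = cong₂ _+_ (I-sym i j) (B-sym i j)

    ∑-row-X : ∀ i → ∑ (X i) ≡ suc k
    ∑-row-X i = trans (∑-distrib-+ (I i) (B i)) (cong₂ _+_ (∑-row-I i) (B-reg i))

    X⊗X : ∀ i j → (X ⊗ X) i j ≡ (I i j + B i j) + (B i j + (B ⊗ B) i j)
    X⊗X i j = trans (⊕-⊗-⊕ I B I B i j)
      (cong₂ _+_ (cong₂ _+_ (I-⊗ I i j) (I-⊗ B i j)) (cong (_+ (B ⊗ B) i j) (⊗-I B i j)))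

    C⊗C-off : ∀ {i j} → i ≢ j → (C ⊗ C) i j + (suc k + suc k) ≡ n + (B i j + (B i j + (B ⊗ B) i j))
    C⊗C-off {i} {j} i≢j = begin
      (C ⊗ C) i j + (suc k + suc k)
        ≡⟨ +-assoc ((C ⊗ C) i j) (suc k) (suc k) ⟨
      (C ⊗ C) i j + suc k + suc k
        ≡⟨ cong₂ (λ r c → (C ⊗ C) i j + r + c) (∑-row-X i) (trans (∑-cong (λ l → X-sym l j)) (∑-row-X j)) ⟨
      (C ⊗ C) i j + ∑ (X i) + ∑ (λ l → X l j)
        ≡⟨ complement-⊗-complement X X-bit i j ⟩
      n + (X ⊗ X) i j
        ≡⟨ cong (n +_) (trans (X⊗X i j) (cong (λ z → (z + B i j) + (B i j + (B ⊗ B) i j)) (I-off i≢j))) ⟩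
      n + (B i j + (B i j + (B ⊗ B) i j)) ∎
      where open ≡-Reasoning

    C-off : ∀ {i j} → i ≢ j → C i j ≡ 1 ∸ B i j
    C-off i≢j = cong (λ z → 1 ∸ (z + _)) (I-off i≢j)

    C-adj⇒B-nonadj : ∀ {i j} → i ≢ j → C i j ≡ 1 → B i j ≡ 0
    C-adj⇒B-nonadj {i} {j} i≢j Cij≡1 with B-bit i j
    ... | inj₁ Bij≡0 = Bij≡0
    ... | inj₂ Bij≡1 with () ← trans (sym Cij≡1) (trans (C-off i≢j) (cong (1 ∸_) Bij≡1))

    C-nonadj⇒B-adj : ∀ {i j} → i ≢ j → C i j ≡ 0 → B i j ≡ 1
    C-nonadj⇒B-adj {i} {j} i≢j Cij≡0 with B-bit i j
    ... | inj₂ Bij≡1 = Bij≡1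
    ... | inj₁ Bij≡0 with () ← trans (sym Cij≡0) (trans (C-off i≢j) (cong (1 ∸_) Bij≡0))

  complement-isSRG : IsSRG n (n ∸ suc k)
                           ((n + mu) ∸ (suc k + suc k))
                           ((n + suc (suc lam)) ∸ (suc k + suc k))
                           (J ⊖ (I ⊕ B))
  complement-isSRG =
    (((λ i j → bit-complement (X-bit i j)) , (λ i j → cong (1 ∸_) (X-sym i j))) ,
      (λ i → cong (1 ∸_) (I⊕-diag (srg .proj₁) i))) ,
    (λ i → m+n≡o⇒m≡o∸n (trans (cong (∑ (C i) +_) (sym (∑-row-X i))) (∑-row-complement X X-bit i))) ,
    (λ i j i≢j Cij≡1 → m+n≡o⇒m≡o∸n (trans (C⊗C-off i≢j) (cong (n +_)
        (let Bij≡0 = C-adj⇒B-nonadj i≢j Cij≡1 in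
         cong₂ (λ b s → b + (b + s)) Bij≡0 (B-nonadj i j i≢j Bij≡0))))) ,
    (λ i j i≢j Cij≡0 → m+n≡o⇒m≡o∸n (trans (C⊗C-off i≢j) (cong (n +_)
        (let Bij≡1 = C-nonadj⇒B-adj i≢j Cij≡0 in
         cong₂ (λ b s → b + (b + s)) Bij≡1 (B-adj i j i≢j Bij≡1)))))

module _ {φ : Fin n → Fin n} (φ-involutive : ∀ v → φ (φ v) ≡ v) where

  private
    P : Matrix n
    P = permMatrix φ

  permMatrix-sym : ∀ i j → P i j ≡ P j i
  permMatrix-sym i j with j ≟ φ i
  ... | yes j≡φi = sym (permMatrix-hit φ (trans (sym (φ-involutive i)) (cong φ (sym j≡φi))))
  ... | no j≢φi  = sym (permMatrix-miss φ (λ i≡φj → j≢φi (trans (sym (φ-involutive j)) (cong φ (sym i≡φj)))))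

  permMatrix-⊗-permMatrix : P ⊗ P ≐ I
  permMatrix-⊗-permMatrix i j =
    trans (permMatrix-⊗ φ P i j) (trans (permMatrix-row-cong φ id (φ-involutive i) j) (sym (I≐permMatrix-id i j)))

  module _ {M : Matrix n} (φ-automorphism : ∀ u v → M (φ u) (φ v) ≡ M u v) where

    automorphism-shift : ∀ i j → M (φ i) j ≡ M i (φ j)
    automorphism-shift i j = trans (sym (φ-automorphism (φ i) j)) (cong (λ u → M u (φ j)) (φ-involutive i))

    ⊗-permMatrix≐permMatrix-⊗ : M ⊗ P ≐ P ⊗ M
    ⊗-permMatrix≐permMatrix-⊗ i j =
      trans (⊗-permMatrix φ φ-involutive M i j) (trans (sym (automorphism-shift i j)) (sym (permMatrix-⊗ φ M i j)))

    permMatrix-⊗-square : (P ⊗ M) ⊗ (P ⊗ M) ≐ λ i j → (M ⊗ M) (φ i) (φ j)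
    permMatrix-⊗-square i j =
      ∑-cong (λ l → cong₂ _*_ (permMatrix-⊗ φ M i l) (trans (permMatrix-⊗ φ M l j) (automorphism-shift l j)))

adjacency-⊗-diag : {M : Matrix n} → IsAdjacency M → ∀ i → (M ⊗ M) i i ≡ ∑ (M i)
adjacency-⊗-diag {M = M} ((M-bit , M-sym) , _) i =
  ∑-cong (λ l → trans (cong (M i l *_) (M-sym l i)) (bit-square (M-bit i l)))

deza-arithmetic : (k lam : ℕ) {s b x : ℕ} → IsBit b →
                  (x ≡ 1 × b ≡ 0 × s ≡ k) ⊎ (x ≡ 0 × s ≡ lam) →
                  s + b + (b + x) ≡ lam * (1 ∸ (x + b)) + suc (suc lam) * b + (k + 1) * x
deza-arithmetic k lam _           (inj₁ (refl , refl , refl)) = solve (k ∷ lam ∷ [])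
deza-arithmetic k lam (inj₁ refl) (inj₂ (refl , refl))        = solve (k ∷ lam ∷ [])
deza-arithmetic k lam (inj₂ refl) (inj₂ (refl , refl))        = solve (k ∷ lam ∷ [])

module _ {n k lam : ℕ} {M : Matrix n} (srg : IsSRG n k lam lam M)
         {φ : Fin n → Fin n} (φ-involutive : ∀ v → φ (φ v) ≡ v)
         (φ-automorphism : ∀ u v → M (φ u) (φ v) ≡ M u v)
         (φ-seidel : ∀ v → φ v ≢ v → M v (φ v) ≡ 0) (φ-fixedPointFree : FixedPointFree φ) where

  private
    M-adjacency = srg .proj₁
    M-bit = srg .proj₁ .proj₁ .proj₁
    M-sym = srg .proj₁ .proj₁ .proj₂
    M-diag = srg .proj₁ .proj₂
    M-reg = srg .proj₂ .proj₁

    P : Matrix n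
    P = permMatrix φ

    B : Matrix n
    B = P ⊗ M

    N : Matrix n
    N = M ⊕ P

    M-φ : ∀ v → M v (φ v) ≡ 0
    M-φ v = φ-seidel v (φ-fixedPointFree v)

    M⊗M-diag : ∀ i → (M ⊗ M) i i ≡ k
    M⊗M-diag i = trans (adjacency-⊗-diag M-adjacency i) (M-reg i)

    M⊗M-off : ∀ {i j} → i ≢ j → (M ⊗ M) i j ≡ lam
    M⊗M-off {i} {j} i≢j with M-bit i j
    ... | inj₁ Mij≡0 = srg .proj₂ .proj₂ .proj₂ i j i≢j Mij≡0
    ... | inj₂ Mij≡1 = srg .proj₂ .proj₂ .proj₁ i j i≢j Mij≡1

    B-entry : ∀ i j → B i j ≡ M i (φ j)
    B-entry i j = trans (permMatrix-⊗ φ M i j) (automorphism-shift φ-involutive φ-automorphism i j)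

    B-adjacency : IsAdjacency B
    B-adjacency =
      ((λ i j → subst IsBit (sym (permMatrix-⊗ φ M i j)) (M-bit (φ i) j)) ,
       (λ i j → trans (B-entry i j) (trans (M-sym i (φ j)) (sym (permMatrix-⊗ φ M j i))))) ,
      (λ i → trans (B-entry i i) (M-φ i))

  permMatrix-⊗-isSRG : IsSRG n k lam lam (permMatrix φ ⊗ M)
  permMatrix-⊗-isSRG =
    B-adjacency ,
    (λ i → trans (∑-cong (permMatrix-⊗ φ M i)) (M-reg (φ i))) ,
    (λ i j i≢j _ → B⊗B-off i≢j) ,
    (λ i j i≢j _ → B⊗B-off i≢j)
    where
    B⊗B-off : ∀ {i j} → i ≢ j → (B ⊗ B) i j ≡ lam
    B⊗B-off {i} {j} i≢j = trans (permMatrix-⊗-square φ-involutive φ-automorphism i j)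
      (M⊗M-off (λ φi≡φj → i≢j (trans (sym (φ-involutive i)) (trans (cong φ φi≡φj) (φ-involutive j)))))

  M⊕permMatrix-isDeza : Connected M →
    IsDezaWithChildren n (k + 1) (suc (suc lam)) lam
      (M ⊕ permMatrix φ) (J ⊖ (I ⊕ (permMatrix φ ⊗ M))) (permMatrix φ ⊗ M)
  M⊕permMatrix-isDeza M-connected =
    ((N-bit , (λ i j → cong₂ _+_ (M-sym i j) (permMatrix-sym φ-involutive i j))) ,
     (λ i → cong₂ _+_ (M-diag i) (permMatrix-miss φ (φ-fixedPointFree i ∘ sym)))) ,
    (λ i → trans (∑-distrib-+ (M i) (P i)) (cong₂ _+_ (M-reg i) (∑-row-permMatrix φ i))) ,
    (λ i j → Star.map M-edge⇒N-edge (M-connected i j)) ,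
    m≤n+m lam 2 ,
    complement-isSRG permMatrix-⊗-isSRG .proj₁ .proj₁ ,
    B-adjacency .proj₁ ,
    complement-⊕-⊕-I B-adjacency ,
    (λ i j → trans (N⊗N i j) (deza-arithmetic k lam (B-adjacency .proj₁ .proj₁ i j) (diagonal-or-off i j)))
    where
    M-miss : ∀ {i j} → M i j ≡ 1 → j ≢ φ i
    M-miss {i} Mij≡1 j≡φi with () ← trans (sym Mij≡1) (trans (cong (M i) j≡φi) (M-φ i))

    N-bit : ∀ i j → IsBit (N i j)
    N-bit i j with M-bit i j
    ... | inj₁ Mij≡0 = by-cases (j ≟ φ i)
      where
      by-cases : Dec (j ≡ φ i) → IsBit (N i j)
      by-cases (yes j≡φi) = inj₂ (cong₂ _+_ Mij≡0 (permMatrix-hit φ j≡φi))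
      by-cases (no j≢φi)  = inj₁ (cong₂ _+_ Mij≡0 (permMatrix-miss φ j≢φi))
    ... | inj₂ Mij≡1 = inj₂ (cong₂ _+_ Mij≡1 (permMatrix-miss φ (M-miss Mij≡1)))

    M-edge⇒N-edge : ∀ {i j} → Adj M i j → Adj N i j
    M-edge⇒N-edge Mij≡1 = cong₂ _+_ Mij≡1 (permMatrix-miss φ (M-miss Mij≡1))

    N⊗N : ∀ i j → (N ⊗ N) i j ≡ (M ⊗ M) i j + B i j + (B i j + I i j)
    N⊗N i j = trans (⊕-⊗-⊕ M P M P i j)
      (cong₂ _+_ (cong ((M ⊗ M) i j +_) (⊗-permMatrix≐permMatrix-⊗ φ-involutive φ-automorphism i j))
                 (cong (B i j +_) (permMatrix-⊗-permMatrix φ-involutive i j)))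

    diagonal-or-off : ∀ i j → (I i j ≡ 1 × B i j ≡ 0 × (M ⊗ M) i j ≡ k) ⊎ (I i j ≡ 0 × (M ⊗ M) i j ≡ lam)
    diagonal-or-off i j = by-cases (i ≟ j)
      where
      by-cases : Dec (i ≡ j) → (I i j ≡ 1 × B i j ≡ 0 × (M ⊗ M) i j ≡ k) ⊎ (I i j ≡ 0 × (M ⊗ M) i j ≡ lam)
      by-cases (yes refl) = inj₁ (I-diag i , B-adjacency .proj₂ i , M⊗M-diag i)
      by-cases (no i≢j)   = inj₂ (I-off i≢j , M⊗M-off i≢j)

theorem8 : (n k lam mu : ℕ) (M : Matrix n) → IsSRG n k lam mu M → Connected M → lam ≡ mu →
    (φ : Fin n → Fin n) → IsSeidelAutomorphism M φ → FixedPointFree φ →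
    Σ ℕ λ k' → Σ ℕ λ b → Σ ℕ λ a →
      IsDezaWithChildren n k' b a (M ⊕ permMatrix φ) (J ⊖ (I ⊕ (permMatrix φ ⊗ M))) (permMatrix φ ⊗ M)
      × IsStronglyRegular (permMatrix φ ⊗ M)
      × IsStronglyRegular (J ⊖ (I ⊕ (permMatrix φ ⊗ M)))
theorem8 n k lam .lam M srg M-connected refl φ (φ-involutive , _ , φ-automorphism , φ-seidel) φ-fixedPointFree =
  k + 1 , suc (suc lam) , lam ,
  M⊕permMatrix-isDeza srg φ-involutive φ-automorphism φ-seidel φ-fixedPointFree M-connected ,
  (k , lam , lam , B-isSRG) ,
  (_ , _ , _ , complement-isSRG B-isSRG)
  where
  B-isSRG : IsSRG n k lam lam (permMatrix φ ⊗ M)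
  B-isSRG = permMatrix-⊗-isSRG srg φ-involutive φ-automorphism φ-seidel φ-fixedPointFree
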